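{- Let $n>1$, let $k_0,\ldots,k_{n-1}$ be integers and $q,p_0,\ldots,p_{n-1}$ non-zero integers with $\gcd(p_i,q)=1$ for all $i$, and assume $D:=q^n-p_0p_1\cdots p_{n-1}\neq 0$. Extend indices periodically ($p_i=p_j$, $k_i=k_j$ when $i\equiv j \pmod n$), let $B_i(x)=\frac{p_ix+k_i}{q}$, and let $x_i$ be the unique (rational) solution of $B_i\circ B_{i+1}\circ\cdots\circ B_{i+n-1}(x)=x$, namely $$x_i=\frac{p_ip_{i+1}\cdots p_{i+n-2}k_{i-1}+p_ip_{i+1}\cdots p_{i+n-3}k_{i-2}q+\cdots+p_ik_{i+1}q^{n-2}+k_iq^{n-1}}{D},$$ with $x_i=x_j$ when $i\equiv j\pmod n$. Put $U_j=\frac{q^j}{D}$. Let $\alpha,\beta$ be non-zero integers and $b$ an integer with $0<b<n$, and suppose $\alpha U_0+\beta U_b$ is an integer. Then for every integer $i$, the number $\alpha x_i+\beta\, p_ip_{i+1}\cdots p_{i+b-1}\,x_{i+b}$ is an integer.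
   Context: All indices are taken modulo $n$. -}

module Defs where

open import Data.Nat using (ℕ; zero; suc)
open import Data.Integer using (ℤ; +_; -[1+_]; _+_; _-_; _*_; -_; _^_; 1ℤ; 0ℤ)
open import Data.Rational using (ℚ; _/_; 0ℚ)
open import Data.Product using (∃-syntax)
open import Relation.Binary.PropositionalEquality using (_≡_)

ιℚ : ℤ → ℚ
ιℚ z = z / 1

-- the rational number a/d; convention a/0 := 0 (only used with d ≠ 0)
_/ℤ_ : ℤ → ℤ → ℚ
a /ℤ (+ zero)  = 0ℚ
a /ℤ (+ suc m) = a / suc m
a /ℤ -[1+ m ]  = (- a) / suc m

IsInteger : ℚ → Set
IsInteger r = ∃[ z ] r ≡ ιℚ z

prodP : (ℤ → ℤ) → ℤ → ℕ → ℤ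
prodP p i zero    = 1ℤ
prodP p i (suc j) = p i * prodP p (i + 1ℤ) j

sumTo : ℕ → (ℕ → ℤ) → ℤ
sumTo zero    f = 0ℤ
sumTo (suc N) f = sumTo N f + f N

Dval : ℕ → ℤ → (ℤ → ℤ) → ℤ
Dval n q p = q ^ n - prodP p 0ℤ n

-- numerator of x_i:
--   Σ_{m=0}^{n-1} p_i p_{i+1} ... p_{i+n-2-m} k_{i-1-m} q^m
-- (term m = n-1 is k_{i-n} q^{n-1} = k_i q^{n-1} by periodicity)
numX : ℕ → ℤ → (ℤ → ℤ) → (ℤ → ℤ) → ℤ → ℤ
numX n q p k i =
  sumTo n (λ m → prodP p i (n Data.Nat.∸ suc m) * k (i - + suc m) * q ^ m)

xval : ℕ → ℤ → (ℤ → ℤ) → (ℤ → ℤ) → ℤ → ℚ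
xval n q p k i = numX n q p k i /ℤ Dval n q p

Uval : ℕ → ℤ → (ℤ → ℤ) → ℕ → ℚ
Uval n q p j = (q ^ j) /ℤ Dval n q p

-- The numerators N_i = D x_i satisfy q N_i = p_i N_{i+1} + D k_i (the fixed-point
-- equation x_i = B_i(x_{i+1}) cleared of denominators). Iterating b times gives
-- q^b N_i ≡ p_i ⋯ p_{i+b-1} N_{i+b} (mod D). The hypothesis says D ∣ α + β q^b, so
-- α N_i + β p_i ⋯ p_{i+b-1} N_{i+b} ≡ (α + β q^b) N_i ≡ 0 (mod D), i.e. the
-- combination of the x's is an integer.
module Submission where

open import Defs
open import Data.Integer.GCD using (gcd)
open import Data.Nat using (ℕ; zero; suc; _∸_; _<_)
import Data.Nat.Properties as ℕ
open import Data.Integer using (ℤ; +_; -[1+_]; +[1+_]; _+_; _-_; _*_; -_; _^_; 0ℤ; 1ℤ)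
import Data.Integer.Properties as ℤ
open import Data.Integer.Divisibility.Signed
  using (_∣_; divides; ∣-refl; ∣m∣n⇒∣m+n; ∣m∣n⇒∣m-n; ∣m⇒∣m*n; ∣n⇒∣m*n)
open import Data.Integer.Tactic.RingSolver using (solve-∀)
open import Data.Product using (_,_)
open import Data.Rational using (1/_; NonZero; ≢-nonZero; toℚᵘ) renaming (_+_ to _+ℚ_; _*_ to _*ℚ_)
open import Data.Rational.Properties
  using (toℚᵘ-injective; toℚᵘ-homo-+; toℚᵘ-homo-*; toℚᵘ-fromℚᵘ; toℚᵘ-cong)
  renaming (*-identityʳ to *ℚ-identityʳ; *-inverseʳ to *ℚ-inverseʳ; *-assoc to *ℚ-assoc; *-distribʳ-+ to *ℚ-distribʳ-+ℚ)
open import Data.Rational.Unnormalised using (mkℚᵘ; *≡*) renaming (_+_ to _+ᵘ_; _*_ to _*ᵘ_; _≃_ to _≃ᵘ_)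
import Data.Rational.Unnormalised.Properties as ℚᵘ
open import Data.Empty using (⊥-elim)
open import Relation.Binary.PropositionalEquality
open import Algebra.Properties.AbelianGroup ℤ.+-0-abelianGroup using () renaming (∙-cancelˡ to +-cancelˡ)

Periodic : ℕ → (ℤ → ℤ) → Set
Periodic n f = ∀ i → f (i + + n) ≡ f i

shift-invariant⇒constant : ∀ {a} {A : Set a} (f : ℤ → A) → (∀ i → f (i + 1ℤ) ≡ f i) → ∀ i → f i ≡ f 0ℤ
shift-invariant⇒constant f f-inv (+ zero)     = refl
shift-invariant⇒constant f f-inv +[1+ m ]     =
  trans (cong (λ j → f (+ j)) (ℕ.+-comm 1 m)) (trans (f-inv (+ m)) (shift-invariant⇒constant f f-inv (+ m)))
shift-invariant⇒constant f f-inv -[1+ zero ]  = sym (f-inv -[1+ zero ])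
shift-invariant⇒constant f f-inv -[1+ suc m ] =
  trans (sym (f-inv -[1+ suc m ])) (shift-invariant⇒constant f f-inv -[1+ m ])

sumTo-cong : ∀ N {f g : ℕ → ℤ} → (∀ m → m < N → f m ≡ g m) → sumTo N f ≡ sumTo N g
sumTo-cong zero    f≗g = refl
sumTo-cong (suc N) f≗g =
  cong₂ _+_ (sumTo-cong N (λ m m<N → f≗g m (ℕ.m<n⇒m<1+n m<N))) (f≗g N ℕ.≤-refl)

sumTo-suc : ∀ N (f : ℕ → ℤ) → sumTo (suc N) f ≡ f 0 + sumTo N (λ m → f (suc m))
sumTo-suc zero    f = ℤ.+-comm 0ℤ (f 0)
sumTo-suc (suc N) f = trans (cong (_+ f (suc N)) (sumTo-suc N f)) (ℤ.+-assoc (f 0) _ (f (suc N)))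

*-distribˡ-sumTo : ∀ N c (f : ℕ → ℤ) → c * sumTo N f ≡ sumTo N (λ m → c * f m)
*-distribˡ-sumTo zero    c f = ℤ.*-zeroʳ c
*-distribˡ-sumTo (suc N) c f =
  trans (ℤ.*-distribˡ-+ c (sumTo N f) (f N)) (cong (_+ c * f N) (*-distribˡ-sumTo N c f))

prodP-suc-last : ∀ p i j → prodP p i (suc j) ≡ prodP p i j * p (i + + j)
prodP-suc-last p i zero    = trans (ℤ.*-identityʳ (p i)) (trans (cong p (sym (ℤ.+-identityʳ i))) (sym (ℤ.*-identityˡ _)))
prodP-suc-last p i (suc j) = begin
  p i * prodP p (i + 1ℤ) (suc j)                  ≡⟨ cong (p i *_) (prodP-suc-last p (i + 1ℤ) j) ⟩
  p i * (prodP p (i + 1ℤ) j * p (i + 1ℤ + + j))   ≡⟨ ℤ.*-assoc (p i) _ _ ⟨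
  p i * prodP p (i + 1ℤ) j * p (i + 1ℤ + + j)     ≡⟨ cong (λ l → p i * prodP p (i + 1ℤ) j * p l) (ℤ.+-assoc i 1ℤ (+ j)) ⟩
  p i * prodP p (i + 1ℤ) j * p (i + + suc j)      ∎
  where open ≡-Reasoning

prodP-period-constant : ∀ {n p} → Periodic n p → ∀ i → prodP p i n ≡ prodP p 0ℤ n
prodP-period-constant {zero}  p-per i = refl
prodP-period-constant {suc n} {p} p-per = shift-invariant⇒constant (λ i → prodP p i (suc n)) shift
  where
  shift : ∀ i → prodP p (i + 1ℤ) (suc n) ≡ prodP p i (suc n)
  shift i = begin
    prodP p (i + 1ℤ) (suc n)                ≡⟨ prodP-suc-last p (i + 1ℤ) n ⟩
    prodP p (i + 1ℤ) n * p (i + 1ℤ + + n)   ≡⟨ cong (λ l → prodP p (i + 1ℤ) n * p l) (ℤ.+-assoc i 1ℤ (+ n)) ⟩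
    prodP p (i + 1ℤ) n * p (i + + suc n)    ≡⟨ cong (prodP p (i + 1ℤ) n *_) (p-per i) ⟩
    prodP p (i + 1ℤ) n * p i                ≡⟨ ℤ.*-comm _ (p i) ⟩
    prodP p i (suc n)                       ∎
    where open ≡-Reasoning

module _ (n : ℕ) (q : ℤ) {p k : ℤ → ℤ} (k-per : Periodic n k) (p-per : Periodic n p) where

  private
    N : ℤ → ℤ
    N = numX n q p k

    D : ℤ
    D = Dval n q p

  -- With T m := p_i ⋯ p_{i+n-m-1} k_{i-m} q^m, both q N_i and p_i N_{i+1} are sums of
  -- n consecutive terms of T 0, …, T n; they differ by T n - T 0 = (q^n - p_0 ⋯ p_{n-1}) k_i.
  numX-recurrence : ∀ i → q * N i ≡ p i * N (i + 1ℤ) + D * k i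
  numX-recurrence i = +-cancelˡ (prodP p 0ℤ n * k i) _ _ (begin
    prodP p 0ℤ n * k i + q * N i               ≡⟨ cong₂ _+_ (sym T-first) q*N≡ ⟩
    T 0 + sumTo n (λ m → T (suc m))            ≡⟨ sumTo-suc n T ⟨
    sumTo n T + T n                            ≡⟨ cong₂ _+_ (sym p*N≡) T-last ⟩
    p i * N (i + 1ℤ) + k i * q ^ n             ≡⟨ rearrange (p i * N (i + 1ℤ)) (k i) (q ^ n) (prodP p 0ℤ n) ⟩
    prodP p 0ℤ n * k i + (p i * N (i + 1ℤ) + D * k i) ∎)
    where
    open ≡-Reasoning
    T : ℕ → ℤ
    T m = prodP p i (n ∸ m) * k (i - + m) * q ^ m

    q*N≡ : q * N i ≡ sumTo n (λ m → T (suc m))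
    q*N≡ = trans (*-distribˡ-sumTo n q _) (sumTo-cong n (λ m _ → pull-q (prodP p i (n ∸ suc m)) (k (i - + suc m)) q (q ^ m)))
      where
      pull-q : ∀ a b q r → q * (a * b * r) ≡ a * b * (q * r)
      pull-q = solve-∀

    p*N≡ : p i * N (i + 1ℤ) ≡ sumTo n T
    p*N≡ = trans (*-distribˡ-sumTo n (p i) _) (sumTo-cong n absorb-p)
      where
      assoc₄ : ∀ a b c d → a * (b * c * d) ≡ a * b * c * d
      assoc₄ = solve-∀
      index : ∀ i m → i + 1ℤ - (1ℤ + m) ≡ i - m
      index = solve-∀
      absorb-p : ∀ m → m < n → p i * (prodP p (i + 1ℤ) (n ∸ suc m) * k (i + 1ℤ - + suc m) * q ^ m) ≡ T m
      absorb-p m m<n = trans (assoc₄ (p i) _ _ _)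
        (cong₂ (λ a b → a * k b * q ^ m) (cong (prodP p i) (sym (ℕ.+-∸-assoc 1 m<n))) (index i (+ m)))

    T-first : T 0 ≡ prodP p 0ℤ n * k i
    T-first = trans (ℤ.*-identityʳ _) (cong₂ (λ a b → a * k b) (prodP-period-constant p-per i) (ℤ.+-identityʳ i))

    T-last : T n ≡ k i * q ^ n
    T-last = cong (_* q ^ n) (begin
      prodP p i (n ∸ n) * k (i - + n)  ≡⟨ cong (λ j → prodP p i j * k (i - + n)) (ℕ.n∸n≡0 n) ⟩
      1ℤ * k (i - + n)                 ≡⟨ ℤ.*-identityˡ _ ⟩
      k (i - + n)                      ≡⟨ k-per (i - + n) ⟨
      k (i - + n + + n)                ≡⟨ cong k (sub-add i (+ n)) ⟩
      k i                              ∎)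
      where
      sub-add : ∀ i j → i - j + j ≡ i
      sub-add = solve-∀

    rearrange : ∀ x K Q P → x + K * Q ≡ P * K + (x + (Q - P) * K)
    rearrange = solve-∀

  numX-congruence : ∀ b i → D ∣ q ^ b * N i - prodP p i b * N (i + + b)
  numX-congruence zero    i = divides 0ℤ (begin
    1ℤ * N i - 1ℤ * N (i + 0ℤ)  ≡⟨ cong (λ j → 1ℤ * N i - 1ℤ * N j) (ℤ.+-identityʳ i) ⟩
    1ℤ * N i - 1ℤ * N i         ≡⟨ vanish (N i) D ⟩
    0ℤ * D                      ∎)
    where
    open ≡-Reasoning
    vanish : ∀ x D → 1ℤ * x - 1ℤ * x ≡ 0ℤ * D
    vanish = solve-∀
  numX-congruence (suc b) i = subst (D ∣_) (sym expand)
    (∣m∣n⇒∣m+n (∣n⇒∣m*n (p i) ih) (∣m⇒∣m*n (k i * q ^ b) ∣-refl))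
    where
    open ≡-Reasoning
    P M : ℤ
    P = prodP p (i + 1ℤ) b
    M = N (i + + suc b)
    ih : D ∣ q ^ b * N (i + 1ℤ) - P * M
    ih = subst (λ j → D ∣ q ^ b * N (i + 1ℤ) - P * N j) (ℤ.+-assoc i 1ℤ (+ b)) (numX-congruence b (i + 1ℤ))
    expand : q * q ^ b * N i - p i * P * M ≡ p i * (q ^ b * N (i + 1ℤ) - P * M) + D * (k i * q ^ b)
    expand = begin
      q * q ^ b * N i - p i * P * M                   ≡⟨ pull-q q (q ^ b) (N i) (p i * P * M) ⟩
      q ^ b * (q * N i) - p i * P * M                 ≡⟨ cong (λ x → q ^ b * x - p i * P * M) (numX-recurrence i) ⟩
      q ^ b * (p i * N (i + 1ℤ) + D * k i) - p i * P * M ≡⟨ regroup (q ^ b) (p i) (N (i + 1ℤ)) D (k i) P M ⟩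
      p i * (q ^ b * N (i + 1ℤ) - P * M) + D * (k i * q ^ b) ∎
      where
      pull-q : ∀ q Q x y → q * Q * x - y ≡ Q * (q * x) - y
      pull-q = solve-∀
      regroup : ∀ Q a x D K P M → Q * (a * x + D * K) - a * P * M ≡ a * (Q * x - P * M) + D * (K * Q)
      regroup = solve-∀

toℚᵘ-ιℚ : ∀ z → toℚᵘ (ιℚ z) ≃ᵘ mkℚᵘ z 0
toℚᵘ-ιℚ z = toℚᵘ-fromℚᵘ (mkℚᵘ z 0)

ιℚ-injective : ∀ {a b} → ιℚ a ≡ ιℚ b → a ≡ b
ιℚ-injective {a} {b} eq = begin
  a        ≡⟨ ℤ.*-identityʳ a ⟨
  a * 1ℤ   ≡⟨ ℚᵘ.drop-*≡* (ℚᵘ.≃-trans (ℚᵘ.≃-sym (toℚᵘ-ιℚ a)) (ℚᵘ.≃-trans (toℚᵘ-cong eq) (toℚᵘ-ιℚ b))) ⟩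
  b * 1ℤ   ≡⟨ ℤ.*-identityʳ b ⟩
  b        ∎
  where open ≡-Reasoning

ιℚ-homo-+ : ∀ a b → ιℚ (a + b) ≡ ιℚ a +ℚ ιℚ b
ιℚ-homo-+ a b = toℚᵘ-injective (begin
  toℚᵘ (ιℚ (a + b))             ≈⟨ toℚᵘ-ιℚ (a + b) ⟩
  mkℚᵘ (a + b) 0                ≈⟨ *≡* (unit a b) ⟩
  mkℚᵘ a 0 +ᵘ mkℚᵘ b 0          ≈⟨ ℚᵘ.+-cong (toℚᵘ-ιℚ a) (toℚᵘ-ιℚ b) ⟨
  toℚᵘ (ιℚ a) +ᵘ toℚᵘ (ιℚ b)    ≈⟨ toℚᵘ-homo-+ (ιℚ a) (ιℚ b) ⟨
  toℚᵘ (ιℚ a +ℚ ιℚ b)           ∎)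
  where
  open ℚᵘ.≃-Reasoning
  unit : ∀ a b → (a + b) * + 1 ≡ (a * + 1 + b * + 1) * + 1
  unit = solve-∀

ιℚ-homo-* : ∀ a b → ιℚ (a * b) ≡ ιℚ a *ℚ ιℚ b
ιℚ-homo-* a b = toℚᵘ-injective (begin
  toℚᵘ (ιℚ (a * b))             ≈⟨ toℚᵘ-ιℚ (a * b) ⟩
  mkℚᵘ (a * b) 0                ≈⟨ ℚᵘ.*-cong (toℚᵘ-ιℚ a) (toℚᵘ-ιℚ b) ⟨
  toℚᵘ (ιℚ a) *ᵘ toℚᵘ (ιℚ b)    ≈⟨ toℚᵘ-homo-* (ιℚ a) (ιℚ b) ⟨
  toℚᵘ (ιℚ a *ℚ ιℚ b)           ∎)
  where open ℚᵘ.≃-Reasoning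

toℚᵘ-/ℤ-*-cancel : ∀ a {d} → d ≢ 0ℤ → toℚᵘ (a /ℤ d) *ᵘ mkℚᵘ d 0 ≃ᵘ mkℚᵘ a 0
toℚᵘ-/ℤ-*-cancel a {+ zero}    d≢0 = ⊥-elim (d≢0 refl)
toℚᵘ-/ℤ-*-cancel a {+[1+ m ]}  _   = ℚᵘ.≃-trans (ℚᵘ.*-congʳ (toℚᵘ-fromℚᵘ (mkℚᵘ a m)))
  (*≡* (trans (drop-unit a (+ suc m)) (cong (λ j → a * + suc j) (sym (ℕ.*-identityʳ m)))))
  where
  drop-unit : ∀ a d → a * d * + 1 ≡ a * d
  drop-unit = solve-∀
toℚᵘ-/ℤ-*-cancel a { -[1+ m ]} _   = ℚᵘ.≃-trans (ℚᵘ.*-congʳ (toℚᵘ-fromℚᵘ (mkℚᵘ (- a) m)))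
  (*≡* (trans (neg-neg a (+ suc m)) (cong (λ j → a * + suc j) (sym (ℕ.*-identityʳ m)))))
  where
  neg-neg : ∀ a d → - a * - d * + 1 ≡ a * d
  neg-neg = solve-∀

/ℤ-*-cancel : ∀ a {d} → d ≢ 0ℤ → (a /ℤ d) *ℚ ιℚ d ≡ ιℚ a
/ℤ-*-cancel a {d} d≢0 = toℚᵘ-injective (begin
  toℚᵘ ((a /ℤ d) *ℚ ιℚ d)         ≈⟨ toℚᵘ-homo-* (a /ℤ d) (ιℚ d) ⟩
  toℚᵘ (a /ℤ d) *ᵘ toℚᵘ (ιℚ d)    ≈⟨ ℚᵘ.*-congˡ {toℚᵘ (a /ℤ d)} (toℚᵘ-ιℚ d) ⟩
  toℚᵘ (a /ℤ d) *ᵘ mkℚᵘ d 0       ≈⟨ toℚᵘ-/ℤ-*-cancel a d≢0 ⟩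
  mkℚᵘ a 0                        ≈⟨ toℚᵘ-ιℚ a ⟨
  toℚᵘ (ιℚ a)                     ∎)
  where open ℚᵘ.≃-Reasoning

*-cancelʳ-ιℚ : ∀ {d} → d ≢ 0ℤ → ∀ {x y} → x *ℚ ιℚ d ≡ y *ℚ ιℚ d → x ≡ y
*-cancelʳ-ιℚ {d} d≢0 {x} {y} eq = begin
  x                       ≡⟨ undo x ⟨
  x *ℚ ιℚ d *ℚ 1/ ιℚ d    ≡⟨ cong (_*ℚ 1/ ιℚ d) eq ⟩
  y *ℚ ιℚ d *ℚ 1/ ιℚ d    ≡⟨ undo y ⟩
  y                       ∎
  where
  open ≡-Reasoning
  instance
    ιℚd≢0 : NonZero (ιℚ d)
    ιℚd≢0 = ≢-nonZero (λ ιℚd≡0 → d≢0 (ιℚ-injective ιℚd≡0))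
  undo : ∀ z → z *ℚ ιℚ d *ℚ 1/ ιℚ d ≡ z
  undo z = trans (*ℚ-assoc z (ιℚ d) _) (trans (cong (z *ℚ_) (*ℚ-inverseʳ (ιℚ d))) (*ℚ-identityʳ z))

/ℤ-linear : ∀ {d} → d ≢ 0ℤ → ∀ a x b y → ιℚ a *ℚ (x /ℤ d) +ℚ ιℚ b *ℚ (y /ℤ d) ≡ (a * x + b * y) /ℤ d
/ℤ-linear {d} d≢0 a x b y = *-cancelʳ-ιℚ d≢0 (begin
  (ιℚ a *ℚ (x /ℤ d) +ℚ ιℚ b *ℚ (y /ℤ d)) *ℚ ιℚ d             ≡⟨ *ℚ-distribʳ-+ℚ (ιℚ d) (ιℚ a *ℚ (x /ℤ d)) (ιℚ b *ℚ (y /ℤ d)) ⟩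
  ιℚ a *ℚ (x /ℤ d) *ℚ ιℚ d +ℚ ιℚ b *ℚ (y /ℤ d) *ℚ ιℚ d       ≡⟨ cong₂ _+ℚ_ (*ℚ-assoc (ιℚ a) _ _) (*ℚ-assoc (ιℚ b) _ _) ⟩
  ιℚ a *ℚ ((x /ℤ d) *ℚ ιℚ d) +ℚ ιℚ b *ℚ ((y /ℤ d) *ℚ ιℚ d)   ≡⟨ cong₂ (λ u v → ιℚ a *ℚ u +ℚ ιℚ b *ℚ v) (/ℤ-*-cancel x d≢0) (/ℤ-*-cancel y d≢0) ⟩
  ιℚ a *ℚ ιℚ x +ℚ ιℚ b *ℚ ιℚ y                                ≡⟨ cong₂ _+ℚ_ (ιℚ-homo-* a x) (ιℚ-homo-* b y) ⟨
  ιℚ (a * x) +ℚ ιℚ (b * y)                                    ≡⟨ ιℚ-homo-+ (a * x) (b * y) ⟨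
  ιℚ (a * x + b * y)                                          ≡⟨ /ℤ-*-cancel (a * x + b * y) d≢0 ⟨
  ((a * x + b * y) /ℤ d) *ℚ ιℚ d                              ∎)
  where open ≡-Reasoning

IsInteger-/ℤ⇒∣ : ∀ {a d} → d ≢ 0ℤ → IsInteger (a /ℤ d) → d ∣ a
IsInteger-/ℤ⇒∣ {a} {d} d≢0 (c , a/d≡c) = divides c (ιℚ-injective (begin
  ιℚ a               ≡⟨ /ℤ-*-cancel a d≢0 ⟨
  (a /ℤ d) *ℚ ιℚ d   ≡⟨ cong (_*ℚ ιℚ d) a/d≡c ⟩
  ιℚ c *ℚ ιℚ d       ≡⟨ ιℚ-homo-* c d ⟨
  ιℚ (c * d)         ∎))
  where open ≡-Reasoning

∣⇒IsInteger-/ℤ : ∀ {a d} → d ≢ 0ℤ → d ∣ a → IsInteger (a /ℤ d)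
∣⇒IsInteger-/ℤ {d = d} d≢0 (divides c refl) =
  c , *-cancelʳ-ιℚ d≢0 (trans (/ℤ-*-cancel (c * d) d≢0) (ιℚ-homo-* c d))

∣a+bQ∧∣QN-PM⇒∣aN+bPM : ∀ {d} a b Q N P M → d ∣ a + b * Q → d ∣ Q * N - P * M → d ∣ a * N + b * P * M
∣a+bQ∧∣QN-PM⇒∣aN+bPM {d} a b Q N P M d∣a+bQ d∣QN-PM =
  subst (d ∣_) (sym (split a b Q N P M)) (∣m∣n⇒∣m-n (∣m⇒∣m*n N d∣a+bQ) (∣n⇒∣m*n b d∣QN-PM))
  where
  split : ∀ a b Q N P M → a * N + b * P * M ≡ (a + b * Q) * N - b * (Q * N - P * M)
  split = solve-∀

corollary3p2 : (n : ℕ) → 1 < n →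
    (k p : ℤ → ℤ) → (q : ℤ) →
    (∀ i → k (i + + n) ≡ k i) →
    (∀ i → p (i + + n) ≡ p i) →
    q ≢ 0ℤ →
    (∀ i → p i ≢ 0ℤ) →
    (∀ i → gcd (p i) q ≡ 1ℤ) →
    Dval n q p ≢ 0ℤ →
    (α β : ℤ) → α ≢ 0ℤ → β ≢ 0ℤ →
    (b : ℕ) → 0 < b → b < n →
    IsInteger ((ιℚ α *ℚ Uval n q p 0) +ℚ (ιℚ β *ℚ Uval n q p b)) →
    (i : ℤ) →
      IsInteger ((ιℚ α *ℚ xval n q p k i)
                 +ℚ (ιℚ (β * prodP p i b) *ℚ xval n q p k (i + + b)))
corollary3p2 n _ k p q k-per p-per _ _ _ D≢0 α β _ _ b _ _ αU₀+βU_b∈ℤ i =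
  subst IsInteger (sym (/ℤ-linear D≢0 α Nᵢ (β * Pᵢ) Nᵢ₊ᵦ))
    (∣⇒IsInteger-/ℤ D≢0 (∣a+bQ∧∣QN-PM⇒∣aN+bPM α β (q ^ b) Nᵢ Pᵢ Nᵢ₊ᵦ D∣α+βqᵇ (numX-congruence n q k-per p-per b i)))
  where
  Nᵢ Nᵢ₊ᵦ Pᵢ : ℤ
  Nᵢ = numX n q p k i
  Nᵢ₊ᵦ = numX n q p k (i + + b)
  Pᵢ = prodP p i b

  D∣α+βqᵇ : Dval n q p ∣ α + β * q ^ b
  D∣α+βqᵇ = subst (λ a → Dval n q p ∣ a + β * q ^ b) (ℤ.*-identityʳ α)
    (IsInteger-/ℤ⇒∣ D≢0 (subst IsInteger (/ℤ-linear D≢0 α 1ℤ β (q ^ b)) αU₀+βU_b∈ℤ))
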